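{- Let $0<s<t_1$ and let $0^s$ be an $(a-c,b-d)$-bispecial factor of $\mathbf u_\beta$ such that $p$ does not divide $a-b$ and $t_{c\oplus1}t_{c\oplus2}\cdots\preceq t_{d\oplus1}t_{d\oplus2}\cdots$ lexicographically. For $n\in\mathbb N$ let $u^{(n)}$ be the $f^n$-image of this bispecial factor (so that $u^{(n)}=\varphi^n(0^s)\varphi^n(c)(c\oplus n)^{ -1}$). Then $\varphi^n(0)$ is the root of $u^{(n)}$, i.e. $u^{(n)}$ is a prefix of $(\varphi^n(0))^\omega$ and is not a prefix of $w'^\omega$ for any nonempty word $w'$ shorter than $\varphi^n(0)$.
   Context: Let $\beta>1$ be a non-simple Parry number: its Rényi expansion of unity $d_\beta(1)=t_1t_2t_3\cdots$ (nonnegative integers with $t_1=\lfloor\beta\rfloor$, $1=\sum_{i\ge1}t_i\beta^{ -i}$, and $t_it_{i+1}\cdots\prec t_1t_2\cdots$ lexicographically for all $i\ge2$) has the form $t_1\cdots t_m(t_{m+1}\cdots t_{m+p})^\omega$ and is not of the form $t_1\cdots t_k0^\omega$, with $m,p\ge1$ least possible (so $t_m\neq t_{m+p}$). Assume $t_1\ge2$. On $\mathcal A=\{0,1,\dots,m+p-1\}$ let $\varphi$ be the substitution $\varphi(k)=0^{t_{k+1}}(k+1)$ for $0\le k\le m+p-2$, $\varphi(m+p-1)=0^{t_{m+p}}m$, and $\mathbf u_\beta=\lim_n\varphi^n(0)$ its fixed point. For $k,\ell\in\mathbb N$, $k\oplus\ell$ is the letter $k+\ell$ if $k+\ell<m+p$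 and $m+((k+\ell-m)\bmod p)$ otherwise; for $k+\ell>0$, $t_{k\oplus\ell}$ denotes $t_{k+\ell}$ if $k+\ell\le m+p$ and $t_{m+1+((k+\ell-m-1)\bmod p)}$ otherwise. $xy^{ -1}$ denotes $x$ with its suffix $y$ erased. Let $t=\min\{t_m,t_{m+p}\}$ and let $z$ be the unique nonzero letter with $z0^tm$ a factor of $\mathbf u_\beta$. For letters $a\ne b$, $c\ne d$, a factor $v$ is an $(a-c,b-d)$-bispecial factor if $avc$ and $bvd$ are both factors of $\mathbf u_\beta$. For distinct letters $x,y$, $f_L(x,y)$ (resp. $f_R(x,y)$) is the longest common suffix (resp. prefix) of $\varphi(x)$ and $\varphi(y)$. The $f$-image of an $(a-c,b-d)$-bispecial factor $v$ is $f(v)=f_L(a,b)\varphi(v)f_R(c,d)$; it is an $(a'-c',b'-d')$-bispecial factor where, with $\mu=\min\{t_{c\oplus1},t_{d\oplus1}\}$, $c',d'$ are the first letters of $0^{t_{c\oplus1}-\mu}(c\oplus1)$ and $0^{t_{d\oplus1}-\mu}(d\oplus1)$, and $a',b'$ are $0$ and $z$ (in some order) if $\{a,b\}=\{m-1,m+p-1\}$ and $a\oplus1,b\oplus1$ otherwise. The $f^n$-image is obtained by applying $f$ $n$ times, updating the extension letters by this rule at each step. -}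

module Defs where

open import Data.Nat using (ℕ; zero; suc; _+_; _∸_; _≤_; _<_; _⊓_; _%_; _≟_; _<?_; ∣_-_∣)
open import Data.Nat.Divisibility using (_∣_)
open import Data.List using (List; []; _∷_; _++_; replicate; concatMap; reverse; length; concat)
open import Data.Product using (Σ; ∃; ∃-syntax; _×_; _,_; proj₁)
open import Data.Sum using (_⊎_)
open import Data.Bool using (Bool; true; false; if_then_else_; _∧_; _∨_)
open import Relation.Nullary using (¬_; yes; no)
open import Relation.Nullary.Decidable using (⌊_⌋)
open import Relation.Binary.PropositionalEquality using (_≡_)

-- Infinite sequences of naturals, indexed from 1 (the value at 0 is ignored).
Seq : Set
Seq = ℕ → ℕ

_≺_ : Seq → Seq → Set
x ≺ y = ∃[ k ] (1 ≤ k × (∀ j → 1 ≤ j → j < k → x j ≡ y j) × x k < y k)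

_⪯_ : Seq → Seq → Set
x ⪯ y = (∀ j → 1 ≤ j → x j ≡ y j) ⊎ (x ≺ y)

shift : ℕ → Seq → Seq
shift i x = λ j → x (i + j)

-- t = t₁t₂⋯ is the Rényi expansion of unity d_β(1) of a non-simple Parry
-- number β with t₁ ≥ 2, eventually periodic with least preperiod m and least
-- period p.  (By Parry's theorem, the sequences with t₁ ≥ 1 and
-- tᵢtᵢ₊₁⋯ ≺ t₁t₂⋯ for all i ≥ 2 are exactly the sequences d_β(1), β > 1.)
record NonSimpleParry (t : Seq) (m p : ℕ) : Set where
  field
    t₁≥2       : 2 ≤ t 1
    admissible : ∀ i → 1 ≤ i → shift i t ≺ t
    m≥1        : 1 ≤ m
    p≥1        : 1 ≤ p
    periodic   : ∀ j → m < j → t (j + p) ≡ t j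
    m-least    : ∀ m' → 1 ≤ m' → (∀ j → m' < j → t (j + p) ≡ t j) → m ≤ m'
    p-least    : ∀ p' → 1 ≤ p' → (∀ j → m < j → t (j + p') ≡ t j) → p ≤ p'
    not-simple : ¬ (∀ j → m < j → t j ≡ 0)

modp : ℕ → ℕ → ℕ
modp x zero    = x
modp x (suc q) = x % suc q

oplus : (m p : ℕ) → ℕ → ℕ → ℕ
oplus m p k l = if ⌊ (k + l) <? (m + p) ⌋ then k + l else m + modp ((k + l) ∸ m) p

Word : Set
Word = List ℕ

-- φ(k) = 0^{t_{k⊕1}} (k⊕1)   (t_{k⊕1} = t_{k+1} by periodicity of t)
φ : (t : Seq) (m p : ℕ) → ℕ → Word
φ t m p k = replicate (t (suc k)) 0 ++ (oplus m p k 1 ∷ [])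

φ* : (t : Seq) (m p : ℕ) → Word → Word
φ* t m p = concatMap (φ t m p)

φ^ : (t : Seq) (m p : ℕ) → ℕ → Word → Word
φ^ t m p zero    w = w
φ^ t m p (suc n) w = φ* t m p (φ^ t m p n w)

-- w is a factor of u_β = lim φⁿ(0): a factor of some φᴺ(0)
Factor : (t : Seq) (m p : ℕ) → Word → Set
Factor t m p w = ∃[ N ] ∃[ xs ] ∃[ ys ] (φ^ t m p N (0 ∷ []) ≡ xs ++ w ++ ys)

Bispecial : (t : Seq) (m p : ℕ) → (v : Word) → (a b c d : ℕ) → Set
Bispecial t m p v a b c d =
  ¬ (a ≡ b) × ¬ (c ≡ d) ×
  Factor t m p (a ∷ v ++ (c ∷ [])) × Factor t m p (b ∷ v ++ (d ∷ []))

lcp : Word → Word → Word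
lcp (x ∷ xs) (y ∷ ys) with x ≟ y
... | yes _ = x ∷ lcp xs ys
... | no _  = []
lcp _ _ = []

lcs : Word → Word → Word
lcs xs ys = reverse (lcp (reverse xs) (reverse ys))

fL fR : (t : Seq) (m p : ℕ) → ℕ → ℕ → Word
fL t m p x y = lcs (φ t m p x) (φ t m p y)
fR t m p x y = lcp (φ t m p x) (φ t m p y)

-- a bispecial factor together with its extension letters a, b, c, d
record BS : Set where
  constructor bs
  field
    word : Word
    ea eb ec ed : ℕ
open BS public

eqb : ℕ → ℕ → Bool
eqb x y = ⌊ x ≟ y ⌋

-- new right letter: first letter of 0^{t_{c⊕1} - μ}(c⊕1)
rightLetter : (t : Seq) (m p : ℕ) → (c d : ℕ) → ℕ
rightLetter t m p c d =
  if eqb (t (suc c) ∸ (t (suc c) ⊓ t (suc d))) 0 then oplus m p c 1 else 0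

-- the f-image (z is the letter with z0^t m a factor of u_β)
fImage : (t : Seq) (m p z : ℕ) → BS → BS
fImage t m p z (bs v a b c d) =
  bs (fL t m p a b ++ φ* t m p v ++ fR t m p c d) a' b'
     (rightLetter t m p c d) (rightLetter t m p d c)
  where
    special : Bool
    special = (eqb a (m ∸ 1) ∧ eqb b (m + p ∸ 1)) ∨ (eqb a (m + p ∸ 1) ∧ eqb b (m ∸ 1))
    a' b' : ℕ
    a' = if special then 0 else oplus m p a 1
    b' = if special then z else oplus m p b 1

fImage^ : (t : Seq) (m p z : ℕ) → ℕ → BS → BS
fImage^ t m p z zero    x = x
fImage^ t m p z (suc n) x = fImage t m p z (fImage^ t m p z n x)

-- u is a prefix of w^ω  (w nonempty)
PrefixOfPower : Word → Word → Set
PrefixOfPower u w = ∃[ k ] ∃[ r ] (concat (replicate k w) ≡ u ++ r)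

IsRoot : Word → Word → Set
IsRoot w u =
  PrefixOfPower u w ×
  (∀ (w' : Word) → 1 ≤ length w' → length w' < length w → ¬ PrefixOfPower u w')

-- Write U n = φⁿ(0) and σ x = x ⊕ 1. As p ∤ a - b, the left letters of the f-images never form the
-- pair {m - 1, m + p - 1} that f treats specially, and the right letters c, d stay distinct with
-- t_{c⊕1}t_{c⊕2}⋯ ⪯ t_{d⊕1}t_{d⊕2}⋯. Then fL = ε, fR = 0^{t_{c⊕1}} and the new right letter is σ c, so an
-- f-image v with right letter c satisfies f(v) σc = φ(v c); iterating, u⁽ⁿ⁾ cₙ = φⁿ(0ˢ c) = (U n)ˢ φⁿ(c).
-- Since c ⪯ 0 (admissibility), φⁿ(c) minus its last letter is a prefix of U n, hence u⁽ⁿ⁾ is a prefix of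
-- (U n)^ω. A shorter period of a word beginning with U n would make U n bordered, but U n is unbordered:
-- a border of φ(w) cannot end inside a block 0^{t_{x+1}}σx (φ(w) ends with a nonzero letter, and a block
-- suffix has fewer than t₁ leading zeros), so it desubstitutes, by injectivity of φ, to a border of w.

module Submission where

open import Defs
open import Data.Bool using (Bool; true; false; if_then_else_; _∧_; _∨_) renaming (T to Tᵇ)
open import Data.Bool.Properties using (T-≡; T-∧; T-∨)
open import Data.Empty using (⊥; ⊥-elim)
open import Data.List using (List; []; _∷_; _++_; _∷ʳ_; replicate; concat; reverse; length; initLast; _∷ʳ′_)
open import Data.List.Properties
  using (++-assoc; ++-identityʳ; ++-conicalʳ; ∷-injective; ∷-injectiveˡ; ∷-injectiveʳ; ∷ʳ-injectiveˡ; ∷ʳ-injectiveʳ)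
open import Data.List.Properties using (concatMap-++; reverse-++; length-++)
open import Data.List.Relation.Unary.All using (All; []; _∷_)
import Data.List.Relation.Unary.All.Properties as All
open import Data.Nat using (ℕ; zero; suc; _+_; _∸_; _*_; _≤_; _<_; _⊓_; ∣_-_∣; z≤n; s≤s; _%_; _/_; NonZero)
open import Data.Nat.Properties
open import Data.Nat.DivMod using (m≡m%n+[m/n]*n; n%n≡0; m%n%n≡m%n; [m+n]%n≡m%n; m%n<n; %-distribˡ-+)
open import Data.Nat.Divisibility using (_∣_; divides)
open import Data.Product using (∃-syntax; _×_; _,_; proj₂)
open import Data.Sum using (_⊎_; inj₁; inj₂)
open import Function using (_∘_)
open import Function.Bundles using (Equivalence)
open import Relation.Nullary using (¬_; Dec; yes; no)
open import Relation.Nullary.Decidable using (⌊_⌋; toWitness)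
open import Relation.Binary.PropositionalEquality

-- Powers and borders of words

module _ {a} {A : Set a} where

  pow : ℕ → List A → List A
  pow k w = concat (replicate k w)

  pow-comm : ∀ k w → pow k w ++ w ≡ w ++ pow k w
  pow-comm zero    w = sym (++-identityʳ w)
  pow-comm (suc k) w = trans (++-assoc w (pow k w) w) (cong (w ++_) (pow-comm k w))

  pow-+ : ∀ i j w → pow (i + j) w ≡ pow i w ++ pow j w
  pow-+ zero    j w = refl
  pow-+ (suc i) j w = trans (cong (w ++_) (pow-+ i j w)) (sym (++-assoc w (pow i w) (pow j w)))

  ++-split-≤ : ∀ (u v x y : List A) → u ++ v ≡ x ++ y → length u ≤ length x →
    ∃[ w ] (x ≡ u ++ w × v ≡ w ++ y)
  ++-split-≤ []      v x       y eq _         = x , refl , eq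
  ++-split-≤ (c ∷ u) v (e ∷ x) y eq (s≤s u≤x) with refl , eq′ ← ∷-injective eq =
    let w , x≡uw , v≡wy = ++-split-≤ u v x y eq′ u≤x in w , cong (c ∷_) x≡uw , v≡wy

  Unbordered : List A → Set a
  Unbordered w = ∀ x y z → x ≢ [] → y ≢ [] → w ≡ x ++ y → w ≡ y ++ z → ⊥

  pow-suc-rotate : ∀ k w′ y x w → pow k w′ ≡ y ++ x → w′ ++ pow k w′ ≡ w ++ x → y ++ x ++ w′ ≡ w ++ x
  pow-suc-rotate k w′ y x w powk≡yx eq = begin
    y ++ x ++ w′      ≡⟨ ++-assoc y x w′ ⟨
    (y ++ x) ++ w′    ≡⟨ cong (_++ w′) powk≡yx ⟨
    pow k w′ ++ w′    ≡⟨ pow-comm k w′ ⟩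
    w′ ++ pow k w′    ≡⟨ eq ⟩
    w ++ x            ∎
    where open ≡-Reasoning

  -- If w x = w′ᵏ⁺¹ and w = w′ y, then y x w′ = w x as well, so y is a border of w.
  unbordered⇒no-short-period : ∀ {w} → Unbordered w → ∀ k w′ x →
    w′ ≢ [] → length w′ < length w → pow k w′ ≢ w ++ x
  unbordered⇒no-short-period {c ∷ w} _ zero w′ x _ _ ()
  unbordered⇒no-short-period {w} unb (suc k) w′ x w′≢[] |w′|<|w| eq
    with y , w≡w′y , powk≡yx ← ++-split-≤ w′ (pow k w′) w x eq (<⇒≤ |w′|<|w|)
    with z , w≡yz , _ ← ++-split-≤ y (x ++ w′) w x (pow-suc-rotate k w′ y x w powk≡yx eq)
                          (subst (length y ≤_) (sym (trans (cong length w≡w′y) (length-++ w′)))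
                            (m≤n+m (length y) (length w′)))
    = unb w′ y z w′≢[] y≢[] w≡w′y w≡yz
    where
    y≢[] : y ≢ []
    y≢[] refl = <-irrefl (sym (cong length (trans w≡w′y (++-identityʳ w′)))) |w′|<|w|

  replicate-suc-∷ʳ : ∀ i (x : A) → replicate (suc i) x ≡ replicate i x ∷ʳ x
  replicate-suc-∷ʳ zero    x = refl
  replicate-suc-∷ʳ (suc i) x = cong (x ∷_) (replicate-suc-∷ʳ i x)

  ++-replicate-suc : ∀ (x u : List A) i a → x ++ u ++ replicate (suc i) a ≡ (x ++ u ++ replicate i a) ∷ʳ a
  ++-replicate-suc x u i a = begin
    x ++ u ++ replicate (suc i) a            ≡⟨ cong (λ r → x ++ u ++ r) (replicate-suc-∷ʳ i a) ⟩
    x ++ u ++ replicate i a ++ a ∷ []        ≡⟨ cong (x ++_) (++-assoc u _ _) ⟨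
    x ++ (u ++ replicate i a) ++ a ∷ []      ≡⟨ ++-assoc x _ _ ⟨
    (x ++ u ++ replicate i a) ∷ʳ a           ∎
    where open ≡-Reasoning

unbordered⇒IsRoot : ∀ {w} → Unbordered w → ∀ k q x → q ++ x ≡ w → IsRoot w (pow (suc k) w ++ q)
unbordered⇒IsRoot {w} unb k q x q++x≡w = (suc (suc k) , x , power-prefix) , no-shorter
  where
  open ≡-Reasoning
  power-prefix : pow (suc (suc k)) w ≡ (pow (suc k) w ++ q) ++ x
  power-prefix = begin
    w ++ pow (suc k) w          ≡⟨ pow-comm (suc k) w ⟨
    pow (suc k) w ++ w          ≡⟨ cong (pow (suc k) w ++_) q++x≡w ⟨
    pow (suc k) w ++ q ++ x     ≡⟨ ++-assoc (pow (suc k) w) q x ⟨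
    (pow (suc k) w ++ q) ++ x   ∎
  no-shorter : ∀ w′ → 1 ≤ length w′ → length w′ < length w → ¬ PrefixOfPower (pow (suc k) w ++ q) w′
  no-shorter w′ 1≤|w′| |w′|<|w| (j , y , powj≡) =
    unbordered⇒no-short-period unb j w′ ((pow k w ++ q) ++ y) w′≢[] |w′|<|w| (begin
      pow j w′                      ≡⟨ powj≡ ⟩
      ((w ++ pow k w) ++ q) ++ y    ≡⟨ cong (_++ y) (++-assoc w (pow k w) q) ⟩
      (w ++ pow k w ++ q) ++ y      ≡⟨ ++-assoc w (pow k w ++ q) y ⟩
      w ++ (pow k w ++ q) ++ y      ∎)
    where
    w′≢[] : w′ ≢ []
    w′≢[] refl = <⇒≱ 1≤|w′| z≤n

zeros-injective : ∀ i j x y (u v : Word) → x ≢ 0 → y ≢ 0 →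
  replicate i 0 ++ x ∷ u ≡ replicate j 0 ++ y ∷ v → i ≡ j × x ≡ y × u ≡ v
zeros-injective zero    zero    x y u v _   _   eq with refl , u≡v ← ∷-injective eq = refl , refl , u≡v
zeros-injective zero    (suc j) x y u v x≢0 _   eq = ⊥-elim (x≢0 (∷-injectiveˡ eq))
zeros-injective (suc i) zero    x y u v _   y≢0 eq = ⊥-elim (y≢0 (sym (∷-injectiveˡ eq)))
zeros-injective (suc i) (suc j) x y u v x≢0 y≢0 eq =
  let i≡j , x≡y , u≡v = zeros-injective i j x y u v x≢0 y≢0 (∷-injectiveʳ eq) in cong suc i≡j , x≡y , u≡v

data ZerosSplit (k x : ℕ) (v y z : Word) : Set where
  before : y ≡ [] → ZerosSplit k x v y z
  among  : ∀ i j → suc i + j ≡ k → y ≡ replicate (suc i) 0 → z ≡ replicate j 0 ++ x ∷ v → ZerosSplit k x v y z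
  after  : ∀ y′ → y ≡ replicate k 0 ++ x ∷ y′ → v ≡ y′ ++ z → ZerosSplit k x v y z

zeros-split : ∀ k x v y z → replicate k 0 ++ x ∷ v ≡ y ++ z → ZerosSplit k x v y z
zeros-split k       x v []      z _  = before refl
zeros-split zero    x v (y ∷ y′) z eq with refl , v≡y′z ← ∷-injective eq = after y′ refl v≡y′z
zeros-split (suc k) x v (y ∷ y′) z eq with refl , eq′ ← ∷-injective eq with zeros-split k x v y′ z eq′
... | before refl                 = among 0 k refl refl (sym eq′)
... | among i j i+j≡k refl z≡     = among (suc i) j (cong suc i+j≡k) refl z≡
... | after y″ refl v≡            = after y″ refl v≡

zeros-∷ : ∀ k → 1 ≤ k → ∀ v → ∃[ w ] (replicate k 0 ++ v ≡ 0 ∷ w)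
zeros-∷ (suc k) _ v = replicate k 0 ++ v , refl

lcp-∷-≢ : ∀ {x y} (u v : Word) → x ≢ y → lcp (x ∷ u) (y ∷ v) ≡ []
lcp-∷-≢ {x} {y} u v x≢y with x ≟ y
... | yes x≡y = ⊥-elim (x≢y x≡y)
... | no  _   = refl

lcp-zeros : ∀ i j x y (u v : Word) → x ≢ 0 → y ≢ 0 → i ≤ j → (i ≡ j → x ≢ y) →
  lcp (replicate i 0 ++ x ∷ u) (replicate j 0 ++ y ∷ v) ≡ replicate i 0
lcp-zeros zero    zero    x y u v _   _   _         x≢y = lcp-∷-≢ u v (x≢y refl)
lcp-zeros zero    (suc j) x y u v x≢0 _   _         _   = lcp-∷-≢ u _ x≢0
lcp-zeros (suc i) (suc j) x y u v x≢0 y≢0 (s≤s i≤j) x≢y =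
  cong (0 ∷_) (lcp-zeros i j x y u v x≢0 y≢0 i≤j (x≢y ∘ cong suc))

-- Congruences modulo p

module _ (P : ℕ) .{{_ : NonZero P}} where

  %-≡⇒∸-multiple : ∀ a b → a % P ≡ b % P → a ∸ b ≡ (a / P ∸ b / P) * P
  %-≡⇒∸-multiple a b a≡b = begin
    a ∸ b                                     ≡⟨ cong₂ _∸_ (m≡m%n+[m/n]*n a P) (m≡m%n+[m/n]*n b P) ⟩
    (a % P + a / P * P) ∸ (b % P + b / P * P) ≡⟨ cong (λ r → (r + a / P * P) ∸ (b % P + b / P * P)) a≡b ⟩
    (b % P + a / P * P) ∸ (b % P + b / P * P) ≡⟨ [m+n]∸[m+o]≡n∸o (b % P) _ _ ⟩
    a / P * P ∸ b / P * P                     ≡⟨ *-distribʳ-∸ P (a / P) (b / P) ⟨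
    (a / P ∸ b / P) * P                       ∎
    where open ≡-Reasoning

  %-≡⇒∣∣-∣ : ∀ a b → a % P ≡ b % P → P ∣ ∣ a - b ∣
  %-≡⇒∣∣-∣ a b a≡b with ∣m-n∣≡[m∸n]∨[n∸m] a b
  ... | inj₁ eq = divides (a / P ∸ b / P) (trans eq (%-≡⇒∸-multiple a b a≡b))
  ... | inj₂ eq = divides (b / P ∸ a / P) (trans eq (%-≡⇒∸-multiple b a (sym a≡b)))

%-suc-injective : ∀ q x y → suc x % suc q ≡ suc y % suc q → x % suc q ≡ y % suc q
%-suc-injective q x y sx≡sy = trans (via x) (trans (cong (λ r → (r + q % suc q) % suc q) sx≡sy) (sym (via y)))
  where
  via : ∀ x → x % suc q ≡ (suc x % suc q + q % suc q) % suc q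
  via x = begin
    x % suc q                             ≡⟨ [m+n]%n≡m%n x (suc q) ⟨
    (x + suc q) % suc q                   ≡⟨ cong (_% suc q) (+-suc x q) ⟩
    (suc x + q) % suc q                   ≡⟨ %-distribˡ-+ (suc x) q (suc q) ⟩
    (suc x % suc q + q % suc q) % suc q   ∎
    where open ≡-Reasoning

if-dec : ∀ {Q : Set} (d : Dec Q) (u v : ℕ) →
  (Q × (if ⌊ d ⌋ then u else v) ≡ u) ⊎ (¬ Q × (if ⌊ d ⌋ then u else v) ≡ v)
if-dec (yes q) u v = inj₁ (q , refl)
if-dec (no ¬q) u v = inj₂ (¬q , refl)

if-∸⊓-≤ : ∀ u v x → u ≤ v → (if eqb (u ∸ (u ⊓ v)) 0 then x else 0) ≡ x
if-∸⊓-≤ zero    v       x _         = refl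
if-∸⊓-≤ (suc u) (suc v) x (s≤s u≤v) = if-∸⊓-≤ u v x u≤v

if-∸⊓-> : ∀ u v x → v < u → (if eqb (u ∸ (u ⊓ v)) 0 then x else 0) ≡ 0
if-∸⊓-> (suc u) zero    x _         = refl
if-∸⊓-> (suc u) (suc v) x (s≤s v<u) = if-∸⊓-> u v x v<u

eqb-∧ : ∀ {a a′ b b′} → Tᵇ (eqb a a′ ∧ eqb b b′) → a ≡ a′ × b ≡ b′
eqb-∧ {a} {a′} {b} {b′} h =
  let h₁ , h₂ = Equivalence.to (T-∧ {eqb a a′}) h in toWitness {a? = a ≟ a′} h₁ , toWitness {a? = b ≟ b′} h₂

-- Lexicographic order

≺⇒head-≤ : ∀ {x y : Seq} → x ≺ y → x 1 ≤ y 1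
≺⇒head-≤ (suc zero    , _ , _     , x₁<y₁) = <⇒≤ x₁<y₁
≺⇒head-≤ (suc (suc k) , _ , agree , _)     = ≤-reflexive (agree 1 ≤-refl (s≤s (s≤s z≤n)))

⪯⇒head-≤ : ∀ {x y : Seq} → x ⪯ y → x 1 ≤ y 1
⪯⇒head-≤ (inj₁ x≗y) = ≤-reflexive (x≗y 1 ≤-refl)
⪯⇒head-≤ (inj₂ x≺y) = ≺⇒head-≤ x≺y

⪯-tail : ∀ {x y : Seq} → x ⪯ y → x 1 ≡ y 1 → shift 1 x ⪯ shift 1 y
⪯-tail (inj₁ x≗y) _ = inj₁ (λ j _ → x≗y (suc j) (s≤s z≤n))
⪯-tail (inj₂ (suc zero , _ , _ , x₁<y₁)) x₁≡y₁ = ⊥-elim (<-irrefl x₁≡y₁ x₁<y₁)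
⪯-tail (inj₂ (suc (suc k) , _ , agree , xₖ<yₖ)) _ =
  inj₂ (suc k , s≤s z≤n , (λ j _ j<k → agree (suc j) (s≤s z≤n) (s≤s j<k)) , xₖ<yₖ)

⪯-resp : ∀ {x x′ y y′ : Seq} → (∀ j → 1 ≤ j → x j ≡ x′ j) → (∀ j → 1 ≤ j → y j ≡ y′ j) →
  x ⪯ y → x′ ⪯ y′
⪯-resp x≗x′ y≗y′ (inj₁ x≗y) =
  inj₁ (λ j 1≤j → trans (sym (x≗x′ j 1≤j)) (trans (x≗y j 1≤j) (y≗y′ j 1≤j)))
⪯-resp x≗x′ y≗y′ (inj₂ (k , 1≤k , agree , xₖ<yₖ)) =
  inj₂ (k , 1≤k ,
        (λ j 1≤j j<k → trans (sym (x≗x′ j 1≤j)) (trans (agree j 1≤j j<k) (y≗y′ j 1≤j))) ,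
        subst₂ _<_ (x≗x′ k 1≤k) (y≗y′ k 1≤k) xₖ<yₖ)

module Parry (t : Seq) (m p′ : ℕ) (H : NonSimpleParry t m (suc p′)) where
  open NonSimpleParry H

  P M : ℕ
  P = suc p′
  M = m + P

  -- φ(x) = 0^(T x) (σ x), with σ x = x ⊕ 1.
  T σ : ℕ → ℕ
  T x = t (suc x)
  σ x = oplus m P x 1

  0<M : 0 < M
  0<M = ≤-trans (s≤s z≤n) (m≤n+m P m)

  σ-cases : ∀ x → (x + 1 < M × σ x ≡ x + 1) ⊎ (¬ x + 1 < M × σ x ≡ m + (x + 1 ∸ m) % P)
  σ-cases x = if-dec (x + 1 <? M) _ _

  σ-letter-cases : ∀ x → x < M → (x + 1 < M × σ x ≡ x + 1) ⊎ (x + 1 ≡ M × σ x ≡ m)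
  σ-letter-cases x x<M with σ-cases x
  ... | inj₁ inc = inj₁ inc
  ... | inj₂ (x+1≮M , σx≡) = inj₂ (x+1≡M , (begin
    σ x                      ≡⟨ σx≡ ⟩
    m + (x + 1 ∸ m) % P      ≡⟨ cong (λ r → m + (r ∸ m) % P) x+1≡M ⟩
    m + (m + P ∸ m) % P      ≡⟨ cong (λ r → m + r % P) (m+n∸m≡n m P) ⟩
    m + P % P                ≡⟨ cong (m +_) (n%n≡0 P) ⟩
    m + 0                    ≡⟨ +-identityʳ m ⟩
    m                        ∎))
    where
    open ≡-Reasoning
    x+1≡M = ≤-antisym (subst (_≤ M) (+-comm 1 x) x<M) (≮⇒≥ x+1≮M)

  σ≢0 : ∀ x → σ x ≢ 0
  σ≢0 x σx≡0 with σ-cases x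
  ... | inj₁ (_ , σx≡) with () ← m+n≡0⇒n≡0 x (trans (sym σx≡) σx≡0)
  ... | inj₂ (_ , σx≡) = <⇒≱ m≥1 (≤-reflexive (m+n≡0⇒m≡0 m (trans (sym σx≡) σx≡0)))

  σ<M : ∀ x → σ x < M
  σ<M x with σ-cases x
  ... | inj₁ (x+1<M , σx≡) = subst (_< M) (sym σx≡) x+1<M
  ... | inj₂ (_ , σx≡)     = subst (_< M) (sym σx≡) (+-monoʳ-< m (m%n<n (x + 1 ∸ m) P))

  σ-% : ∀ x → σ x % P ≡ suc x % P
  σ-% x with σ-cases x
  ... | inj₁ (_ , σx≡) = cong (_% P) (trans σx≡ (+-comm x 1))
  ... | inj₂ (x+1≮M , σx≡) = begin
    σ x % P                                  ≡⟨ cong (_% P) σx≡ ⟩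
    (m + (x + 1 ∸ m) % P) % P                ≡⟨ %-distribˡ-+ m _ P ⟩
    (m % P + (x + 1 ∸ m) % P % P) % P        ≡⟨ cong (λ r → (m % P + r) % P) (m%n%n≡m%n (x + 1 ∸ m) P) ⟩
    (m % P + (x + 1 ∸ m) % P) % P            ≡⟨ %-distribˡ-+ m _ P ⟨
    (m + (x + 1 ∸ m)) % P                    ≡⟨ cong (_% P) (m+[n∸m]≡n (≤-trans (m≤m+n m P) (≮⇒≥ x+1≮M))) ⟩
    (x + 1) % P                              ≡⟨ cong (_% P) (+-comm x 1) ⟩
    suc x % P                                ∎
    where open ≡-Reasoning

  σ-≢-% : ∀ {a b} → a % P ≢ b % P → σ a % P ≢ σ b % P
  σ-≢-% {a} {b} a≢b σa≡σb = a≢b (%-suc-injective p′ a b (trans (sym (σ-% a)) (trans σa≡σb (σ-% b))))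

  m∸1-preperiod : t m ≡ t M → ∀ j → m ∸ 1 < j → t (j + P) ≡ t j
  m∸1-preperiod tₘ≡tₘ₊ₚ j m-1<j with m≤n⇒m<n∨m≡n (subst (_≤ j) (m+[n∸m]≡n m≥1) m-1<j)
  ... | inj₁ m<j  = periodic j m<j
  ... | inj₂ refl = sym tₘ≡tₘ₊ₚ

  -- Equality would make m - 1 a smaller preperiod; for m = 1 it would make t purely periodic,
  -- contradicting the admissibility of shift p t.
  tₘ≢tₘ₊ₚ : t m ≢ t M
  tₘ≢tₘ₊ₚ tₘ≡tₘ₊ₚ with 1 ≤? m ∸ 1
  ... | yes 1≤m-1 =
    1+n≰n (subst (_≤ m ∸ 1) (sym (m+[n∸m]≡n m≥1)) (m-least (m ∸ 1) 1≤m-1 (m∸1-preperiod tₘ≡tₘ₊ₚ)))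
  ... | no 1≰m-1 with k , 1≤k , _ , tₚ₊ₖ<tₖ ← admissible P (s≤s z≤n) =
    <-irrefl (trans (cong t (+-comm P k)) (m∸1-preperiod tₘ≡tₘ₊ₚ k (≤-<-trans (≮⇒≥ 1≰m-1) 1≤k)))
             tₚ₊ₖ<tₖ

  t-σ+ : ∀ x j → x < M → 1 ≤ j → t (σ x + j) ≡ t (x + suc j)
  t-σ+ x j x<M 1≤j with σ-letter-cases x x<M
  ... | inj₁ (_ , σx≡) = cong t (trans (cong (_+ j) σx≡) (+-assoc x 1 j))
  ... | inj₂ (x+1≡M , σx≡) = begin
    t (σ x + j)        ≡⟨ cong (λ r → t (r + j)) σx≡ ⟩
    t (m + j)          ≡⟨ periodic (m + j) (m<m+n m 1≤j) ⟨
    t (m + j + P)      ≡⟨ cong t (+-assoc m j P) ⟩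
    t (m + (j + P))    ≡⟨ cong (λ r → t (m + r)) (+-comm j P) ⟩
    t (m + (P + j))    ≡⟨ cong t (+-assoc m P j) ⟨
    t (M + j)          ≡⟨ cong (λ r → t (r + j)) x+1≡M ⟨
    t (x + 1 + j)      ≡⟨ cong t (+-assoc x 1 j) ⟩
    t (x + suc j)      ∎
    where open ≡-Reasoning

  _⊑_ : ℕ → ℕ → Set
  x ⊑ y = shift x t ⪯ shift y t

  shift-head : ∀ x → shift x t 1 ≡ T x
  shift-head x = cong t (+-comm x 1)

  ⊑-head : ∀ {x y} → x ⊑ y → T x ≤ T y
  ⊑-head {x} {y} x⊑y = subst₂ _≤_ (shift-head x) (shift-head y) (⪯⇒head-≤ x⊑y)

  ⊑-σ : ∀ {x y} → x < M → y < M → x ⊑ y → T x ≡ T y → σ x ⊑ σ y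
  ⊑-σ {x} {y} x<M y<M x⊑y Tx≡Ty =
    ⪯-resp (λ j 1≤j → sym (t-σ+ x j x<M 1≤j)) (λ j 1≤j → sym (t-σ+ y j y<M 1≤j))
      (⪯-tail x⊑y (trans (shift-head x) (trans Tx≡Ty (sym (shift-head y)))))

  ⊑-0 : ∀ x → x ⊑ 0
  ⊑-0 zero    = inj₁ (λ _ _ → refl)
  ⊑-0 (suc x) = inj₂ (admissible (suc x) (s≤s z≤n))

  T≤t₁ : ∀ x → T x ≤ t 1
  T≤t₁ x = ⊑-head (⊑-0 x)

  T≡T⇒tₘ≡tₘ₊ₚ : ∀ {x y} → x + 1 ≡ m → y + 1 ≡ M → T x ≡ T y → t m ≡ t M
  T≡T⇒tₘ≡tₘ₊ₚ {x} {y} x+1≡m y+1≡M Tx≡Ty = begin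
    t m         ≡⟨ cong t x+1≡m ⟨
    t (x + 1)   ≡⟨ shift-head x ⟩
    T x         ≡⟨ Tx≡Ty ⟩
    T y         ≡⟨ shift-head y ⟨
    t (y + 1)   ≡⟨ cong t y+1≡M ⟩
    t M         ∎
    where open ≡-Reasoning

  φ-letter-injective : ∀ {x y} → x < M → y < M → T x ≡ T y → σ x ≡ σ y → x ≡ y
  φ-letter-injective {x} {y} x<M y<M Tx≡Ty σx≡σy with σ-letter-cases x x<M | σ-letter-cases y y<M
  ... | inj₁ (_ , σx≡) | inj₁ (_ , σy≡) = +-cancelʳ-≡ 1 x y (trans (sym σx≡) (trans σx≡σy σy≡))
  ... | inj₂ (x+1≡M , _) | inj₂ (y+1≡M , _) = +-cancelʳ-≡ 1 x y (trans x+1≡M (sym y+1≡M))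
  ... | inj₁ (_ , σx≡) | inj₂ (y+1≡M , σy≡) =
    ⊥-elim (tₘ≢tₘ₊ₚ (T≡T⇒tₘ≡tₘ₊ₚ (trans (sym σx≡) (trans σx≡σy σy≡)) y+1≡M Tx≡Ty))
  ... | inj₂ (x+1≡M , σx≡) | inj₁ (_ , σy≡) =
    ⊥-elim (tₘ≢tₘ₊ₚ (T≡T⇒tₘ≡tₘ₊ₚ (trans (sym σy≡) (trans (sym σx≡σy) σx≡)) x+1≡M (sym Tx≡Ty)))

  -- The substitution φ

  Φ : Word → Word
  Φ = φ* t m P

  Φ^ : ℕ → Word → Word
  Φ^ = φ^ t m P

  U : ℕ → Word
  U n = Φ^ n (0 ∷ [])

  Φ-++ : ∀ u v → Φ (u ++ v) ≡ Φ u ++ Φ v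
  Φ-++ = concatMap-++ (φ t m P)

  Φ-∷ : ∀ x w → Φ (x ∷ w) ≡ replicate (T x) 0 ++ σ x ∷ Φ w
  Φ-∷ x w = ++-assoc (replicate (T x) 0) (σ x ∷ []) (Φ w)

  Φ-∷≢[] : ∀ x w → Φ (x ∷ w) ≢ []
  Φ-∷≢[] x w eq with () ← ++-conicalʳ (replicate (T x) 0) _ (trans (sym (Φ-∷ x w)) eq)

  Φ⁻-≢[] : ∀ {w y} → y ≡ Φ w → y ≢ [] → w ≢ []
  Φ⁻-≢[] y≡Φw y≢[] refl = y≢[] y≡Φw

  Φ-∷ʳ : ∀ w x → Φ (w ∷ʳ x) ≡ (Φ w ++ replicate (T x) 0) ∷ʳ σ x
  Φ-∷ʳ w x = begin
    Φ (w ∷ʳ x)                              ≡⟨ Φ-++ w (x ∷ []) ⟩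
    Φ w ++ φ t m P x ++ []                  ≡⟨ cong (Φ w ++_) (++-identityʳ (φ t m P x)) ⟩
    Φ w ++ replicate (T x) 0 ++ σ x ∷ []    ≡⟨ ++-assoc (Φ w) (replicate (T x) 0) (σ x ∷ []) ⟨
    (Φ w ++ replicate (T x) 0) ∷ʳ σ x       ∎
    where open ≡-Reasoning

  Φ-last-≢0 : ∀ w v → w ≢ [] → Φ w ≢ v ∷ʳ 0
  Φ-last-≢0 w v w≢[] eq with initLast w
  ... | []       = w≢[] refl
  ... | w₀ ∷ʳ′ x = σ≢0 x (∷ʳ-injectiveʳ (Φ w₀ ++ replicate (T x) 0) v (trans (sym (Φ-∷ʳ w₀ x)) eq))

  Φ-injective : ∀ {u v} → All (_< M) u → All (_< M) v → Φ u ≡ Φ v → u ≡ v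
  Φ-injective {[]}    {[]}    _ _ _ = refl
  Φ-injective {[]}    {b ∷ v} _ _ eq = ⊥-elim (Φ-∷≢[] b v (sym eq))
  Φ-injective {a ∷ u} {[]}    _ _ eq = ⊥-elim (Φ-∷≢[] a u eq)
  Φ-injective {a ∷ u} {b ∷ v} (a<M ∷ u<M) (b<M ∷ v<M) eq
    with Ta≡Tb , σa≡σb , Φu≡Φv ← zeros-injective (T a) (T b) (σ a) (σ b) (Φ u) (Φ v) (σ≢0 a) (σ≢0 b)
                                   (trans (sym (Φ-∷ a u)) (trans eq (Φ-∷ b v)))
    = cong₂ _∷_ (φ-letter-injective a<M b<M Ta≡Tb σa≡σb) (Φ-injective u<M v<M Φu≡Φv)

  Φ-letters : ∀ w → All (_< M) (Φ w)
  Φ-letters []      = []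
  Φ-letters (x ∷ w) = All.++⁺ (All.++⁺ (All.replicate⁺ (T x) 0<M) (σ<M x ∷ [])) (Φ-letters w)

  U-letters : ∀ n → All (_< M) (U n)
  U-letters zero    = 0<M ∷ []
  U-letters (suc n) = Φ-letters (U n)

  -- Unborderedness of φⁿ(0)

  U-head : ∀ n → ∃[ w ] (U n ≡ 0 ∷ w)
  U-head zero = [] , refl
  U-head (suc n)
    with w , U≡0∷w ← U-head n
    with w′ , eq ← zeros-∷ (T 0) (≤-trans (s≤s z≤n) t₁≥2) (σ 0 ∷ Φ w) =
    w′ , trans (cong Φ U≡0∷w) (trans (Φ-∷ 0 w) eq)

  U≢[] : ∀ n → U n ≢ []
  U≢[] n U≡[] with () ← trans (sym (proj₂ (U-head n))) U≡[]

  U-prefix-head : ∀ n {y z} → y ≢ [] → U n ≡ y ++ z → ∃[ y′ ] (y ≡ 0 ∷ y′)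
  U-prefix-head n {[]}    y≢[] _   = ⊥-elim (y≢[] refl)
  U-prefix-head n {a ∷ y} _    U≡yz with refl ← ∷-injectiveˡ (trans (sym U≡yz) (proj₂ (U-head n))) = y , refl

  data Cut (w y z : Word) : Set where
    at-boundary : ∀ y′ z′ → w ≡ y′ ++ z′ → y ≡ Φ y′ → z ≡ Φ z′ → Cut w y z
    inside      : ∀ y′ x z′ i j → w ≡ y′ ++ x ∷ z′ → suc i + j ≡ T x →
                  y ≡ Φ y′ ++ replicate (suc i) 0 → z ≡ replicate j 0 ++ σ x ∷ Φ z′ → Cut w y z

  cut : ∀ w y z → Φ w ≡ y ++ z → Cut w y z
  cut [] [] z eq = at-boundary [] [] refl refl (sym eq)
  cut (x ∷ w) y z eq with zeros-split (T x) (σ x) (Φ w) y z (trans (sym (Φ-∷ x w)) eq)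
  ... | before refl = at-boundary [] (x ∷ w) refl refl (sym eq)
  ... | among i j i+j≡Tx y≡ z≡ = inside [] x w i j refl i+j≡Tx y≡ z≡
  ... | after y₁ y≡ Φw≡ with cut w y₁ z Φw≡
  ...   | at-boundary y′ z′ w≡ y₁≡ z≡ =
    at-boundary (x ∷ y′) z′ (cong (x ∷_) w≡)
      (trans y≡ (trans (cong (λ r → replicate (T x) 0 ++ σ x ∷ r) y₁≡) (sym (Φ-∷ x y′)))) z≡
  ...   | inside y′ x′ z′ i j w≡ i+j≡Tx′ y₁≡ z≡ =
    inside (x ∷ y′) x′ z′ i j (cong (x ∷_) w≡) i+j≡Tx′ (begin
      y                                                           ≡⟨ y≡ ⟩
      replicate (T x) 0 ++ σ x ∷ y₁                               ≡⟨ cong (λ r → replicate (T x) 0 ++ σ x ∷ r) y₁≡ ⟩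
      replicate (T x) 0 ++ (σ x ∷ Φ y′) ++ replicate (suc i) 0    ≡⟨ ++-assoc (replicate (T x) 0) _ _ ⟨
      (replicate (T x) 0 ++ σ x ∷ Φ y′) ++ replicate (suc i) 0    ≡⟨ cong (_++ replicate (suc i) 0) (Φ-∷ x y′) ⟨
      Φ (x ∷ y′) ++ replicate (suc i) 0                           ∎) z≡
    where open ≡-Reasoning

  -- A proper suffix of a block φ(x) starts with fewer than T x ≤ t₁ zeros, Φ (0 ∷ w) with exactly t₁.
  Φ-0∷-≢-inside : ∀ w i j x v → suc i + j ≡ T x → Φ (0 ∷ w) ≢ replicate j 0 ++ σ x ∷ v
  Φ-0∷-≢-inside w i j x v i+j≡Tx eq
    with T0≡j , _ ← zeros-injective (T 0) j (σ 0) (σ x) (Φ w) v (σ≢0 0) (σ≢0 x) (trans (sym (Φ-∷ 0 w)) eq)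
    = <-irrefl (sym T0≡j) (<-≤-trans (m<n+m j (s≤s z≤n)) (≤-trans (≤-reflexive i+j≡Tx) (T≤t₁ x)))

  U-unbordered : ∀ n → Unbordered (U n)
  U-unbordered zero    []      y z x≢[] _    _  _ = x≢[] refl
  U-unbordered zero    (_ ∷ x) y z _    y≢[] eq _ = y≢[] (++-conicalʳ x y (sym (∷-injectiveʳ eq)))
  U-unbordered (suc n) x y z x≢[] y≢[] U≡xy U≡yz with cut (U n) y z U≡yz
  ... | inside y′ _ _ i _ _ _ y≡ _ =
    Φ-last-≢0 (U n) (x ++ Φ y′ ++ replicate i 0) (U≢[] n)
      (trans U≡xy (trans (cong (x ++_) y≡) (++-replicate-suc x (Φ y′) i 0)))
  ... | at-boundary y′ z′ U≡y′z′ y≡Φy′ _ with cut (U n) x y U≡xy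
  ...   | at-boundary x′ y″ U≡x′y″ x≡Φx′ y≡Φy″ =
    U-unbordered n x′ y′ z′ (Φ⁻-≢[] x≡Φx′ x≢[]) (Φ⁻-≢[] y≡Φy′ y≢[])
      (trans U≡x′y″ (cong (x′ ++_) y″≡y′)) U≡y′z′
    where
    y″≡y′ : y″ ≡ y′
    y″≡y′ = Φ-injective (All.++⁻ʳ x′ (subst (All (_< M)) U≡x′y″ (U-letters n)))
                        (All.++⁻ˡ y′ (subst (All (_< M)) U≡y′z′ (U-letters n)))
                        (trans (sym y≡Φy″) y≡Φy′)
  ...   | inside _ r z″ i j _ i+j≡Tr _ y≡inside
    with y₁ , refl ← U-prefix-head n {y′} (Φ⁻-≢[] y≡Φy′ y≢[]) U≡y′z′ =
    Φ-0∷-≢-inside y₁ i j r (Φ z″) i+j≡Tr (trans (sym y≡Φy′) y≡inside)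

  Φ^-++ : ∀ n u v → Φ^ n (u ++ v) ≡ Φ^ n u ++ Φ^ n v
  Φ^-++ zero    u v = refl
  Φ^-++ (suc n) u v = trans (cong Φ (Φ^-++ n u v)) (Φ-++ (Φ^ n u) (Φ^ n v))

  Φ^-[] : ∀ n → Φ^ n [] ≡ []
  Φ^-[] zero    = refl
  Φ^-[] (suc n) = cong Φ (Φ^-[] n)

  Φ^-zeros : ∀ n k → Φ^ n (replicate k 0) ≡ pow k (U n)
  Φ^-zeros n zero    = Φ^-[] n
  Φ^-zeros n (suc k) = trans (Φ^-++ n (0 ∷ []) (replicate k 0)) (cong (U n ++_) (Φ^-zeros n k))

  Φ^-Φ : ∀ n w → Φ^ n (Φ w) ≡ Φ (Φ^ n w)
  Φ^-Φ zero    w = refl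
  Φ^-Φ (suc n) w = cong Φ (Φ^-Φ n w)

  Φ^-suc-letter : ∀ n x → Φ^ (suc n) (x ∷ []) ≡ pow (T x) (U n) ++ Φ^ n (σ x ∷ [])
  Φ^-suc-letter n x = begin
    Φ (Φ^ n (x ∷ []))                                  ≡⟨ Φ^-Φ n (x ∷ []) ⟨
    Φ^ n (φ t m P x ++ [])                             ≡⟨ cong (Φ^ n) (++-identityʳ (φ t m P x)) ⟩
    Φ^ n (replicate (T x) 0 ++ σ x ∷ [])               ≡⟨ Φ^-++ n (replicate (T x) 0) (σ x ∷ []) ⟩
    Φ^ n (replicate (T x) 0) ++ Φ^ n (σ x ∷ [])        ≡⟨ cong (_++ Φ^ n (σ x ∷ [])) (Φ^-zeros n (T x)) ⟩
    pow (T x) (U n) ++ Φ^ n (σ x ∷ [])                 ∎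
    where open ≡-Reasoning

  Φ^-suc-∷ʳ : ∀ n x {q e} → Φ^ n (σ x ∷ []) ≡ q ∷ʳ e → Φ^ (suc n) (x ∷ []) ≡ (pow (T x) (U n) ++ q) ∷ʳ e
  Φ^-suc-∷ʳ n x {q} {e} eq =
    trans (Φ^-suc-letter n x) (trans (cong (pow (T x) (U n) ++_) eq) (sym (++-assoc (pow (T x) (U n)) q (e ∷ []))))

  Φ^-init-prefix : ∀ n {x y} → x < M → y < M → x ⊑ y →
    ∃[ q ] ∃[ e ] ∃[ r ] (Φ^ n (x ∷ []) ≡ q ∷ʳ e × q ++ r ≡ Φ^ n (y ∷ []))
  Φ^-init-prefix zero {x} {y} _ _ _ = [] , x , y ∷ [] , refl , refl
  Φ^-init-prefix (suc n) {x} {y} x<M y<M x⊑y with m≤n⇒m<n∨m≡n (⊑-head x⊑y)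
  ... | inj₂ Tx≡Ty with q , e , r , Φσx≡ , qr≡Φσy ← Φ^-init-prefix n (σ<M x) (σ<M y) (⊑-σ x<M y<M x⊑y Tx≡Ty) =
    pow (T x) (U n) ++ q , e , r , Φ^-suc-∷ʳ n x Φσx≡ , (begin
      (pow (T x) (U n) ++ q) ++ r         ≡⟨ ++-assoc (pow (T x) (U n)) q r ⟩
      pow (T x) (U n) ++ q ++ r           ≡⟨ cong₂ (λ k w → pow k (U n) ++ w) Tx≡Ty qr≡Φσy ⟩
      pow (T y) (U n) ++ Φ^ n (σ y ∷ [])  ≡⟨ Φ^-suc-letter n y ⟨
      Φ^ (suc n) (y ∷ [])                 ∎)
    where open ≡-Reasoning
  ... | inj₁ Tx<Ty with q , e , r , Φσx≡ , qr≡U ← Φ^-init-prefix n (σ<M x) 0<M (⊑-0 (σ x))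
                   with o , Tx+1+o≡Ty ← m≤n⇒∃[o]m+o≡n Tx<Ty =
    Uˣ ++ q , e , r ++ pow o (U n) ++ Φσy , Φ^-suc-∷ʳ n x Φσx≡ , (begin
      (Uˣ ++ q) ++ r ++ pow o (U n) ++ Φσy    ≡⟨ ++-assoc Uˣ q _ ⟩
      Uˣ ++ q ++ r ++ pow o (U n) ++ Φσy      ≡⟨ cong (Uˣ ++_) (++-assoc q r _) ⟨
      Uˣ ++ (q ++ r) ++ pow o (U n) ++ Φσy    ≡⟨ cong (λ w → Uˣ ++ w ++ pow o (U n) ++ Φσy) qr≡U ⟩
      Uˣ ++ U n ++ pow o (U n) ++ Φσy         ≡⟨ cong (Uˣ ++_) (++-assoc (U n) _ Φσy) ⟨
      Uˣ ++ pow (suc o) (U n) ++ Φσy          ≡⟨ ++-assoc Uˣ _ Φσy ⟨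
      (Uˣ ++ pow (suc o) (U n)) ++ Φσy        ≡⟨ cong (_++ Φσy) (pow-+ (T x) (suc o) (U n)) ⟨
      pow (T x + suc o) (U n) ++ Φσy          ≡⟨ cong (λ k → pow k (U n) ++ Φσy) (trans (+-suc (T x) o) Tx+1+o≡Ty) ⟩
      pow (T y) (U n) ++ Φσy                  ≡⟨ Φ^-suc-letter n y ⟨
      Φ^ (suc n) (y ∷ [])                     ∎)
    where
    open ≡-Reasoning
    Uˣ = pow (T x) (U n)
    Φσy = Φ^ n (σ y ∷ [])

  -- f-images

  record OrderedPair (c d : ℕ) : Set where
    field
      c<M : c < M
      d<M : d < M
      c≢d : c ≢ d
      c⊑d : c ⊑ d

  ordered-σ≢ : ∀ {c d} → OrderedPair c d → T c ≡ T d → σ c ≢ σ d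
  ordered-σ≢ cd Tc≡Td σc≡σd = c≢d (φ-letter-injective c<M d<M Tc≡Td σc≡σd)
    where open OrderedPair cd

  rightLetter-≤ : ∀ {c d} → T c ≤ T d → rightLetter t m P c d ≡ σ c
  rightLetter-≤ {c} {d} = if-∸⊓-≤ (T c) (T d) (σ c)

  rightLetter-next : ∀ {c d} → OrderedPair c d → OrderedPair (σ c) (rightLetter t m P d c)
  rightLetter-next {c} {d} cd with m≤n⇒m<n∨m≡n (⊑-head (OrderedPair.c⊑d cd))
  ... | inj₁ Tc<Td rewrite if-∸⊓-> (T d) (T c) (σ d) Tc<Td = record
    { c<M = σ<M c ; d<M = 0<M ; c≢d = σ≢0 c ; c⊑d = ⊑-0 (σ c) }
  ... | inj₂ Tc≡Td rewrite rightLetter-≤ {d} {c} (≤-reflexive (sym Tc≡Td)) = record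
    { c<M = σ<M c ; d<M = σ<M d ; c≢d = ordered-σ≢ cd Tc≡Td ; c⊑d = ⊑-σ c<M d<M c⊑d Tc≡Td }
    where open OrderedPair cd

  fR-ordered : ∀ {c d} → OrderedPair c d → fR t m P c d ≡ replicate (T c) 0
  fR-ordered {c} {d} cd = lcp-zeros (T c) (T d) (σ c) (σ d) [] [] (σ≢0 c) (σ≢0 d) (⊑-head c⊑d) (ordered-σ≢ cd)
    where open OrderedPair cd

  fL-≢ : ∀ {a b} → σ a ≢ σ b → fL t m P a b ≡ []
  fL-≢ {a} {b} σa≢σb = cong reverse (trans
    (cong₂ lcp (reverse-++ (replicate (T a) 0) (σ a ∷ [])) (reverse-++ (replicate (T b) 0) (σ b ∷ [])))
    (lcp-∷-≢ _ _ σa≢σb))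

  -- The test fImage applies to its left letters; the pair it singles out is congruent modulo p.
  special : ℕ → ℕ → Bool
  special a b = (eqb a (m ∸ 1) ∧ eqb b (M ∸ 1)) ∨ (eqb a (M ∸ 1) ∧ eqb b (m ∸ 1))

  m∸1≡M∸1-% : (m ∸ 1) % P ≡ (M ∸ 1) % P
  m∸1≡M∸1-% = trans (sym ([m+n]%n≡m%n (m ∸ 1) P)) (cong (_% P) (sym (+-∸-comm P m≥1)))

  special⇒≡-% : ∀ a b → Tᵇ (special a b) → a % P ≡ b % P
  special⇒≡-% a b sp with Equivalence.to (T-∨ {eqb a (m ∸ 1) ∧ eqb b (M ∸ 1)}) sp
  ... | inj₁ a,b with refl , refl ← eqb-∧ {a} {m ∸ 1} {b} {M ∸ 1} a,b = m∸1≡M∸1-%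
  ... | inj₂ a,b with refl , refl ← eqb-∧ {a} {M ∸ 1} {b} {m ∸ 1} a,b = sym m∸1≡M∸1-%

  not-special : ∀ a b → a % P ≢ b % P → special a b ≡ false
  not-special a b a≢b with special a b in sp
  ... | true  = ⊥-elim (a≢b (special⇒≡-% a b (Equivalence.from T-≡ sp)))
  ... | false = refl

  factor-letters : ∀ {w} → Factor t m P w → All (_< M) w
  factor-letters (N , xs , ys , U≡) = All.++⁻ˡ _ (All.++⁻ʳ xs (subst (All (_< M)) U≡ (U-letters N)))

  factor-last-< : ∀ {a} v {c} → Factor t m P (a ∷ v ++ c ∷ []) → c < M
  factor-last-< v fac with _ ∷ v,c<M ← factor-letters fac with c<M ∷ [] ← All.++⁻ʳ v v,c<M = c<M

  module _ (z : ℕ) where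

    f : BS → BS
    f = fImage t m P z

    ea-f : ∀ v a b c d → a % P ≢ b % P → ea (f (bs v a b c d)) ≡ σ a
    ea-f v a b c d a≢b = cong (λ sp → if sp then 0 else σ a) (not-special a b a≢b)

    eb-f : ∀ v a b c d → a % P ≢ b % P → eb (f (bs v a b c d)) ≡ σ b
    eb-f v a b c d a≢b = cong (λ sp → if sp then z else σ b) (not-special a b a≢b)

    -- The extension conditions of the theorem, in the form in which f preserves them.
    record Regular (β : BS) : Set where
      field
        ea≢eb : ea β % P ≢ eb β % P
        right : OrderedPair (ec β) (ed β)

    f-good : ∀ β → Regular β → Regular (f β)
    f-good (bs v a b c d) good = record
      { ea≢eb = subst₂ (λ a′ b′ → a′ % P ≢ b′ % P) (sym (ea-f v a b c d ea≢eb)) (sym (eb-f v a b c d ea≢eb))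
                  (σ-≢-% ea≢eb)
      ; right = subst (λ c′ → OrderedPair c′ (rightLetter t m P d c)) (sym (rightLetter-≤ (⊑-head c⊑d)))
                  (rightLetter-next right) }
      where
      open Regular good
      open OrderedPair right

    f-word : ∀ β → Regular β → word (f β) ∷ʳ ec (f β) ≡ Φ (word β ∷ʳ ec β)
    f-word (bs v a b c d) good = begin
      (fL t m P a b ++ Φ v ++ fR t m P c d) ∷ʳ rightLetter t m P c d
        ≡⟨ cong₂ (λ l r → (l ++ Φ v ++ r) ∷ʳ rightLetter t m P c d)
                 (fL-≢ (σ-≢-% ea≢eb ∘ cong (_% P))) (fR-ordered right) ⟩
      (Φ v ++ replicate (T c) 0) ∷ʳ rightLetter t m P c d
        ≡⟨ cong ((Φ v ++ replicate (T c) 0) ∷ʳ_) (rightLetter-≤ (⊑-head c⊑d)) ⟩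
      (Φ v ++ replicate (T c) 0) ∷ʳ σ c
        ≡⟨ Φ-∷ʳ v c ⟨
      Φ (v ∷ʳ c) ∎
      where
      open ≡-Reasoning
      open Regular good
      open OrderedPair right

    f^-good : ∀ β → Regular β → ∀ n → Regular (fImage^ t m P z n β)
    f^-good β good zero    = good
    f^-good β good (suc n) = f-good _ (f^-good β good n)

    f^-word : ∀ β → Regular β → ∀ n →
      word (fImage^ t m P z n β) ∷ʳ ec (fImage^ t m P z n β) ≡ Φ^ n (word β ∷ʳ ec β)
    f^-word β good zero    = refl
    f^-word β good (suc n) = trans (f-word _ (f^-good β good n)) (cong Φ (f^-word β good n))

    f^-root : ∀ s′ a b c d → a % P ≢ b % P → OrderedPair c d → ∀ n →
      IsRoot (U n) (word (fImage^ t m P z n (bs (replicate (suc s′) 0) a b c d)))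
    f^-root s′ a b c d a≢b cd n with q , e , r , Φc≡qe , qr≡U ← Φ^-init-prefix n (OrderedPair.c<M cd) 0<M (⊑-0 c) =
      subst (IsRoot (U n)) (sym word≡) (unbordered⇒IsRoot (U-unbordered n) s′ q r qr≡U)
      where
      s = suc s′
      βₙ = fImage^ t m P z n (bs (replicate s 0) a b c d)
      open ≡-Reasoning
      word≡ : word βₙ ≡ pow s (U n) ++ q
      word≡ = ∷ʳ-injectiveˡ (word βₙ) (pow s (U n) ++ q) (begin
        word βₙ ∷ʳ ec βₙ                               ≡⟨ f^-word _ (record { ea≢eb = a≢b ; right = cd }) n ⟩
        Φ^ n (replicate s 0 ++ c ∷ [])                 ≡⟨ Φ^-++ n (replicate s 0) (c ∷ []) ⟩
        Φ^ n (replicate s 0) ++ Φ^ n (c ∷ [])          ≡⟨ cong₂ _++_ (Φ^-zeros n s) Φc≡qe ⟩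
        pow s (U n) ++ q ∷ʳ e                          ≡⟨ ++-assoc (pow s (U n)) q (e ∷ []) ⟨
        (pow s (U n) ++ q) ∷ʳ e                        ∎)

lemma6p7 : (t : Seq) (m p : ℕ) → NonSimpleParry t m p →
    (z : ℕ) → ¬ (z ≡ 0) → Factor t m p (z ∷ replicate (t m ⊓ t (m + p)) 0 ++ (m ∷ [])) →
    (s a b c d : ℕ) → 0 < s → s < t 1 →
    Bispecial t m p (replicate s 0) a b c d →
    ¬ (p ∣ ∣ a - b ∣) →
    shift c t ⪯ shift d t →
    (n : ℕ) → IsRoot (φ^ t m p n (0 ∷ [])) (word (fImage^ t m p z n (bs (replicate s 0) a b c d)))
lemma6p7 t m zero H with () ← NonSimpleParry.p≥1 H
lemma6p7 t m (suc p′) H z _ _ (suc s′) a b c d _ _ (_ , c≢d , a0ˢc , b0ˢd) p∤a-b c⊑d =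
  f^-root z s′ a b c d (p∤a-b ∘ %-≡⇒∣∣-∣ (suc p′) a b) c,d-ordered
  where
  open Parry t m p′ H
  c,d-ordered : OrderedPair c d
  c,d-ordered = record
    { c<M = factor-last-< (replicate (suc s′) 0) a0ˢc
    ; d<M = factor-last-< (replicate (suc s′) 0) b0ˢd
    ; c≢d = c≢d
    ; c⊑d = c⊑d }
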